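{- Let $G$ be a directed graph in which every vertex has indegree $1$ or outdegree $1$. Let $(a_1,a_2,\dots,a_n)$ be a sequence of edges of $G$ such that for all $i>1$ the origin of $a_i$ is the terminus of $a_{i-1}$, the origin of $a_1$ has outdegree $1$, and the terminus of $a_n$ has indegree $1$. Then there exist a directed path $P$ from the origin of $a_1$ to the terminus of $a_n$ and directed circuits $C_1,\dots,C_k$ such that $\sum_{i=1}^n\{a_i\}=P+\sum_{i=1}^k C_i$ and $P\cup\bigcup_{i=1}^k C_i=\{a_1,\dots,a_n\}$.
   Context: Paths and circuits are identified with their edge sets; $+$ and $\sum$ denote symmetric difference of edge sets (sum over $\mathbb{Z}_2$, counting repeated edges with multiplicity). -}

module Defs where

open import Data.Nat using (ℕ; zero; suc; _+_)
open import Data.Fin using (Fin; _≟_)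
open import Data.List using (List; []; _∷_; map; length; filter)
open import Data.List using (allFin)
open import Data.List.Relation.Unary.Unique.Propositional using (Unique)
open import Data.Product using (_×_)
open import Data.Empty using (⊥)
open import Relation.Binary.PropositionalEquality using (_≡_)

record Digraph : Set where
  field
    nV : ℕ
    nE : ℕ
    orig : Fin nE → Fin nV
    term : Fin nE → Fin nV

module _ (G : Digraph) where
  open Digraph G

  Vertex : Set
  Vertex = Fin nV

  Edge : Set
  Edge = Fin nE

  indeg : Vertex → ℕ
  indeg v = length (filter (λ e → term e ≟ v) (allFin nE))

  outdeg : Vertex → ℕ
  outdeg v = length (filter (λ e → orig e ≟ v) (allFin nE))

  data Walk : Vertex → List Edge → Vertex → Set where
    nil  : ∀ {u} → Walk u [] u
    cons : ∀ {u v} e {es} → orig e ≡ u → Walk (term e) es v → Walk u (e ∷ es) v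

  IsPath : Vertex → List Edge → Vertex → Set
  IsPath u es v = Walk u es v × Unique (u ∷ map term es)

  IsCircuit : List Edge → Set
  IsCircuit [] = ⊥
  IsCircuit (e ∷ es) = Walk (orig e) (e ∷ es) (orig e) × Unique (map orig (e ∷ es))

  mult : Edge → List Edge → ℕ
  mult e es = length (filter (λ f → f ≟ e) es)

{-# OPTIONS --safe #-}
-- Loop erasure. Read the walk from its last edge backwards, maintaining a path
-- from the current vertex to v together with a list of circuits. To prepend an
-- edge e, either its origin is not yet on the path, and e extends the path, or
-- the origin is visited by the path, and e followed by the path up to that
-- visit is a circuit, which is split off. Every edge of the walk thus lands in
-- exactly one of P, C₁, …, Cₖ: the walk is a permutation of P ++ C₁ ++ … ++ Cₖ,
-- which gives both the multiplicity and the union identities.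
module Submission where

open import Defs
open import Data.Nat using (_+_; _%_)
open import Data.List using (List; []; _∷_; map; _++_; concat; filter; length)
open import Data.List.Properties using (++-assoc; filter-++; length-++)
open import Data.Nat.ListAction using (sum)
open import Data.List.Relation.Unary.All using (All; []; _∷_)
open import Data.List.Relation.Unary.All.Properties using (++⁻)
open import Data.List.Relation.Unary.All.Properties.Core using (¬Any⇒All¬)
open import Data.List.Relation.Unary.Any using (Any; here; there; any?)
open import Data.List.Relation.Unary.Any.Properties using (concat⁺; concat⁻)
open import Data.List.Relation.Unary.AllPairs using ([]; _∷_)
open import Data.List.Relation.Unary.Unique.Propositional using (Unique)
open import Data.List.Membership.Propositional using (_∈_)
open import Data.List.Membership.Propositional.Properties using (∈-++⁺ˡ; ∈-++⁺ʳ; ∈-++⁻)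
open import Data.List.Relation.Binary.Permutation.Propositional
  using (_↭_; ↭-refl; ↭-prep; ↭-sym; module PermutationReasoning)
open import Data.List.Relation.Binary.Permutation.Propositional.Properties
  using (shifts; filter-↭; ↭-length; ∈-resp-↭)
open import Data.Fin using (_≟_)
open import Data.Product using (Σ; _×_; _,_; proj₁; proj₂)
open import Data.Sum using (_⊎_; [_,_]; map₂)
open import Function using (_∘_)
open import Function.Bundles using (_⇔_; mk⇔)
open import Relation.Nullary using (yes; no)
open import Relation.Binary.PropositionalEquality
  using (_≡_; _≢_; refl; sym; trans; cong; subst; module ≡-Reasoning)

module _ {A : Set} where

  Unique-++-∷⁻ : ∀ xs {u : A} {ys} → Unique (xs ++ u ∷ ys) →
                 Unique (u ∷ xs) × Unique (u ∷ ys)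
  Unique-++-∷⁻ []       u∷ys               = [] ∷ [] , u∷ys
  Unique-++-∷⁻ (x ∷ xs) (x∉xs++u∷ys ∷ uniq) with Unique-++-∷⁻ xs uniq | ++⁻ xs x∉xs++u∷ys
  ... | u∉xs ∷ u∷xs , u∷ys | x∉xs , x≢u ∷ _ =
    ((x≢u ∘ sym) ∷ u∉xs) ∷ x∉xs ∷ u∷xs , u∷ys

  ∈-↭-++-concat : ∀ {xs ys zss} → xs ↭ ys ++ concat zss →
                  ∀ (x : A) → (x ∈ xs) ⇔ (x ∈ ys ⊎ Any (x ∈_) zss)
  ∈-↭-++-concat {ys = ys} {zss} xs↭ _ =
    mk⇔ (map₂ (concat⁻ zss) ∘ ∈-++⁻ ys ∘ ∈-resp-↭ xs↭)
        (∈-resp-↭ (↭-sym xs↭) ∘ [ ∈-++⁺ˡ , ∈-++⁺ʳ ys ∘ concat⁺ ])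

module _ (G : Digraph) where
  open Digraph G using (orig; term)

  splitWalkAt : ∀ {w P v x} → Walk G w P v → x ∈ w ∷ map term P →
                Σ (List (Edge G)) λ Q → Σ (List (Edge G)) λ R →
                  P ≡ Q ++ R × Walk G w Q x × Walk G x R v
  splitWalkAt {P = P} W    (here refl) = [] , P , refl , nil , W
  splitWalkAt (cons f o W) (there x∈) with splitWalkAt W x∈
  ... | Q , R , refl , WQ , WR = f ∷ Q , R , refl , cons f o WQ , WR

  visited-++ : ∀ {w Q x} → Walk G w Q x → ∀ R →
               w ∷ map term (Q ++ R) ≡ map orig Q ++ x ∷ map term R
  visited-++ nil             R = refl
  visited-++ (cons f refl W) R = cong (orig f ∷_) (visited-++ W R)

  record PathCircuitDecomposition (u : Vertex G) (as : List (Edge G)) (v : Vertex G) : Set where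
    field
      path             : List (Edge G)
      circuits         : List (List (Edge G))
      isPath           : IsPath G u path v
      areCircuits      : All (IsCircuit G) circuits
      ↭-path++circuits : as ↭ path ++ concat circuits

  prependEdge : ∀ e {es v} → PathCircuitDecomposition (term e) es v →
                PathCircuitDecomposition (orig e) (e ∷ es) v
  prependEdge e {es} record { path = P ; circuits = Cs ; isPath = W , uniq
                            ; areCircuits = Cs-areCircuits ; ↭-path++circuits = es↭ }
    with any? (orig e ≟_) (term e ∷ map term P)
  ... | no orig∉P = record
    { path = e ∷ P ; circuits = Cs ; isPath = cons e refl W , ¬Any⇒All¬ _ orig∉P ∷ uniq
    ; areCircuits = Cs-areCircuits ; ↭-path++circuits = ↭-prep e es↭ }
  ... | yes orig∈P with splitWalkAt W orig∈P
  ... | Q , R , refl , WQ , WR = record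
    { path = R ; circuits = (e ∷ Q) ∷ Cs ; isPath = WR , uniqR
    ; areCircuits = (cons e refl WQ , uniqCircuit) ∷ Cs-areCircuits
    ; ↭-path++circuits = e∷es↭ }
    where
      uniqCircuit×uniqR : Unique (orig e ∷ map orig Q) × Unique (orig e ∷ map term R)
      uniqCircuit×uniqR = Unique-++-∷⁻ (map orig Q) (subst Unique (visited-++ WQ R) uniq)
      uniqCircuit : Unique (orig e ∷ map orig Q)
      uniqCircuit = proj₁ uniqCircuit×uniqR
      uniqR : Unique (orig e ∷ map term R)
      uniqR = proj₂ uniqCircuit×uniqR
      open PermutationReasoning
      e∷es↭ : e ∷ es ↭ R ++ (e ∷ Q) ++ concat Cs
      e∷es↭ = begin
        e ∷ es                   <⟨ es↭ ⟩
        e ∷ (Q ++ R) ++ concat Cs ≡⟨ cong (e ∷_) (++-assoc Q R (concat Cs)) ⟩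
        (e ∷ Q) ++ R ++ concat Cs ↭⟨ shifts (e ∷ Q) R ⟩
        R ++ (e ∷ Q) ++ concat Cs ∎

  decompose : ∀ {u as v} → Walk G u as v → PathCircuitDecomposition u as v
  decompose nil = record
    { path = [] ; circuits = [] ; isPath = nil , [] ∷ []
    ; areCircuits = [] ; ↭-path++circuits = ↭-refl }
  decompose (cons e refl W) = prependEdge e (decompose W)

  mult-resp-↭ : ∀ e {as bs} → as ↭ bs → mult G e as ≡ mult G e bs
  mult-resp-↭ e = ↭-length ∘ filter-↭ (_≟ e)

  mult-++ : ∀ e as bs → mult G e (as ++ bs) ≡ mult G e as + mult G e bs
  mult-++ e as bs = trans (cong length (filter-++ (_≟ e) as bs)) (length-++ (filter (_≟ e) as))

  mult-concat : ∀ e Cs → mult G e (concat Cs) ≡ sum (map (mult G e) Cs)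
  mult-concat e []       = refl
  mult-concat e (C ∷ Cs) = trans (mult-++ e C (concat Cs)) (cong (mult G e C +_) (mult-concat e Cs))

  mult-↭-++-concat : ∀ e {as P Cs} → as ↭ P ++ concat Cs →
                     mult G e as ≡ mult G e P + sum (map (mult G e) Cs)
  mult-↭-++-concat e {as} {P} {Cs} as↭ = begin
    mult G e as                          ≡⟨ mult-resp-↭ e as↭ ⟩
    mult G e (P ++ concat Cs)            ≡⟨ mult-++ e P (concat Cs) ⟩
    mult G e P + mult G e (concat Cs)    ≡⟨ cong (mult G e P +_) (mult-concat e Cs) ⟩
    mult G e P + sum (map (mult G e) Cs) ∎
    where open ≡-Reasoning

mainTheorem3 : (G : Digraph) →
    ((x : Vertex G) → indeg G x ≡ 1 ⊎ outdeg G x ≡ 1) →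
    (u v : Vertex G) (as : List (Edge G)) → as ≢ [] → Walk G u as v →
    outdeg G u ≡ 1 → indeg G v ≡ 1 →
    Σ (List (Edge G)) λ P → Σ (List (List (Edge G))) λ Cs →
    IsPath G u P v × All (IsCircuit G) Cs ×
    ((e : Edge G) → mult G e as % 2 ≡ (mult G e P + sum (map (mult G e) Cs)) % 2) ×
    ((e : Edge G) → (e ∈ as) ⇔ (e ∈ P ⊎ Any (e ∈_) Cs))
mainTheorem3 G _ u v as _ W _ _ =
  path , circuits , isPath , areCircuits ,
  (λ e → cong (_% 2) (mult-↭-++-concat G e {P = path} {circuits} ↭-path++circuits)) ,
  ∈-↭-++-concat ↭-path++circuits
  where open PathCircuitDecomposition (decompose G W)
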